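{- Let $F\in\mathsf{IndFor}_+$. The following are equivalent: (a) $F$ is an indexed linear tree; (b) the support of $\mathbf c(F)$ is an interval in $\mathbb{Z}_{\ge1}$; (c) $\mathrm{LSupp}(F)$ is an interval in $\mathbb{Z}_{\ge1}$. In this case, write $\mathbf c(F)=(0^j,\alpha_1,\dots,\alpha_k)$ with $j\ge0$, $\alpha_i>0$ for $i=1,\dots,k$, and all later entries $0$. Then $\mathfrak{P}_F=F_\alpha(x_1,\dots,x_{k+j})$, the Gessel fundamental quasisymmetric polynomial indexed by the composition $\alpha=(\alpha_1,\dots,\alpha_k)$.
   Context: Indexed forests: for finite $S\subset\mathbb{Z}$ with maximal consecutive blocks $I_1<\cdots<I_k$, an indexed forest $F$ with support $S$ is a tuple of plane binary trees $T_j$ with $|I_j|$ nodes, canonically labeled by $I_j$ in inorder (missing children are leaves). $\mathsf{IndFor}_+$ denotes those with $S\subset\mathbb{Z}_{\ge1}$. An indexed linear tree is an indexed forest consisting of a single tree that is a path (each node has at most one child). $\mathrm{LSupp}(F)$ is the set of canonical labels of nodes with no left child. $\rho_F(v)$ is the canonical label of the node reached from $v$ by following left children as long as possible. $\mathbf c(F)=(c_i)$ with $c_i=\#\{v:\rho_F(v)=i\}$. The forest polynomial is $\mathfrak{P}_F=\sum_\kappa\prod_vx_{\kappa(v)}$ over $\kappa:\operatorname{IN}(F)\to\mathbb{Z}_{\ge1}$ with $\kappa(v)\le\rho_F(v)$, $\kappa(\text{left child of }u)\ge\kappa(u)$, and $\kappa(\text{right child of }u)>\kappa(u)$. -}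

module Defs where

open import Data.Nat using (ℕ; zero; suc; _+_; _≤_; _<_; _≤ᵇ_; _<ᵇ_; _≡ᵇ_; _≟_)
open import Data.Bool using (Bool; true; false; _∧_; if_then_else_)
open import Data.List using (List; []; _∷_; _++_; [_]; length; map; filter; concatMap; splitAt; null; upTo)
open import Data.Nat.ListAction using (sum)
open import Data.Bool.ListAction using (any)
open import Data.List.Relation.Unary.All using (All)
open import Data.List.Relation.Unary.Linked using (Linked)
open import Data.Product using (_×_; _,_; Σ; ∃; proj₁; proj₂)
open import Data.Unit using (⊤)
open import Data.Empty using (⊥)
open import Relation.Binary.PropositionalEquality using (_≡_; _≢_)
open import Function using (_⇔_)
import Data.List.Relation.Binary.Permutation.Propositional as PermP
import Data.List.Relation.Binary.Permutation.Setoid as PermS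

-- Plane binary trees (leaf = missing child, node l r = internal node)

data Tree : Set where
  leaf : Tree
  node : Tree → Tree → Tree

size : Tree → ℕ
size leaf = 0
size (node l r) = size l + suc (size r)

-- A block is (s , T): the tree T canonically labelled in inorder by the
-- consecutive integers s, s+1, ..., s + size T - 1.
-- An indexed forest in IndFor₊ is a list of blocks, left to right, with
-- nonempty trees, labels ≥ 1, and a gap of at least one integer between
-- consecutive blocks (so the blocks are exactly the maximal consecutive
-- blocks of the support).

Block : Set
Block = ℕ × Tree

NonEmptyTree : Tree → Set
NonEmptyTree leaf = ⊥
NonEmptyTree (node _ _) = ⊤

Separated : Block → Block → Set
Separated (s , t) (s' , t') = suc (s + size t) ≤ s'

record IndFor₊ : Set where
  constructor indFor
  field
    blocks    : List Block
    nonempty  : All (λ b → NonEmptyTree (proj₂ b)) blocks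
    positive  : All (λ b → 1 ≤ proj₁ b) blocks
    separated : Linked Separated blocks
open IndFor₊ public

IsPath : Tree → Set
IsPath leaf = ⊤
IsPath (node leaf r) = IsPath r
IsPath (node (node a b) leaf) = IsPath (node a b)
IsPath (node (node a b) (node c d)) = ⊥

IsLinear : IndFor₊ → Set
IsLinear F = Σ Block (λ b → blocks F ≡ [ b ] × IsPath (proj₂ b))

leftEnd : ℕ → Tree → ℕ
leftEnd s leaf = s
leftEnd s (node leaf r) = s
leftEnd s (node (node a b) r) = leftEnd s (node a b)

hasLeftChild : Tree → Bool
hasLeftChild leaf = false
hasLeftChild (node leaf r) = false
hasLeftChild (node (node _ _) r) = true

record NodeInfo : Set where
  constructor info
  field
    label   : ℕ
    rho     : ℕ
    hasLeft : Bool
open NodeInfo public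

nodesT : ℕ → Tree → List NodeInfo
nodesT s leaf = []
nodesT s (node l r) =
  nodesT s l ++ info (s + size l) (leftEnd s (node l r)) (hasLeftChild (node l r)) ∷ nodesT (suc (s + size l)) r

nodes : IndFor₊ → List NodeInfo
nodes F = concatMap (λ b → nodesT (proj₁ b) (proj₂ b)) (blocks F)

LSupp : IndFor₊ → List ℕ
LSupp F = map label (filter (λ v → hasLeft v Data.Bool.≟ false) (nodes F))

InLSupp : IndFor₊ → ℕ → Set
InLSupp F i = Data.List.Membership.Propositional._∈_ i (LSupp F)
  where import Data.List.Membership.Propositional

cF : IndFor₊ → ℕ → ℕ
cF F i = length (filter (λ v → rho v ≟ i) (nodes F))

SuppC : IndFor₊ → ℕ → Set
SuppC F i = 1 ≤ i × cF F i ≢ 0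

IsInterval : (ℕ → Set) → Set
IsInterval P = Σ ℕ λ a → Σ ℕ λ b → 1 ≤ a × a ≤ b × (∀ i → P i ⇔ (a ≤ i × i ≤ b))

-- Polynomials with ℕ coefficients in x_1, x_2, ...:
-- a monomial x_{i_1} ⋯ x_{i_m} is the list [i_1, ..., i_m] (up to
-- permutation), a polynomial is a list of monomials (a multiset of
-- monomials, i.e. a sum of monomials with multiplicity).

Monomial : Set
Monomial = List ℕ

Poly : Set
Poly = List Monomial

-- equality of polynomials: same multiset of monomials, where monomials
-- are compared up to reordering of the variables
open PermS (PermP.↭-setoid {A = ℕ}) public using () renaming (_↭_ to _≈ₚ_)

allLists : ℕ → ℕ → List (List ℕ)
allLists zero B = [ [] ]
allLists (suc n) B = concatMap (λ x → map (x ∷_) (allLists n B)) (map suc (upTo B))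

-- Forest polynomials.
-- A labelling κ of the internal nodes is stored as the list of its values
-- in inorder (i.e. in increasing order of canonical labels).

-- okT lo s t ks : ks (in inorder) is a valid assignment on the tree t
-- labelled from s, whose root value must be ≥ lo; conditions:
-- κ(v) ≤ ρ(v), κ(left child of u) ≥ κ(u), κ(right child of u) > κ(u).
okT : ℕ → ℕ → Tree → List ℕ → Bool
okT lo s leaf ks = null ks
okT lo s (node l r) ks = go (splitAt (size l) ks)
  where
  go : List ℕ × List ℕ → Bool
  go (kl , []) = false
  go (kl , k ∷ kr) =
    (lo ≤ᵇ k) ∧ (k ≤ᵇ leftEnd s (node l r))
      ∧ okT k s l kl ∧ okT (suc k) (suc (s + size l)) r kr

okF : List Block → List ℕ → Bool
okF [] ks = null ks
okF ((s , t) ∷ bs) ks = okT 1 s t (proj₁ (splitAt (size t) ks)) ∧ okF bs (proj₂ (splitAt (size t) ks))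

numNodes : IndFor₊ → ℕ
numNodes F = sum (map (λ b → size (proj₂ b)) (blocks F))

-- an upper bound for all canonical labels (hence for all κ(v) ≤ ρ(v))
labelBound : IndFor₊ → ℕ
labelBound F = sum (map (λ b → proj₁ b + size (proj₂ b)) (blocks F))

forestPoly : IndFor₊ → Poly
forestPoly F = filter (λ κ → okF (blocks F) κ Data.Bool.≟ true) (allLists (numNodes F) (labelBound F))

-- Gessel's fundamental quasisymmetric polynomial F_α(x_1, ..., x_n):
-- sum of x_{i_1} ⋯ x_{i_m}, m = |α|, over 1 ≤ i_1 ≤ ... ≤ i_m ≤ n with
-- i_p < i_{p+1} whenever p ∈ Set(α) = {α_1, α_1+α_2, ..., α_1+...+α_{k-1}}.

size-α : List ℕ → ℕ
size-α = sum

descentSet : ℕ → List ℕ → List ℕ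
descentSet acc [] = []
descentSet acc (a ∷ []) = []
descentSet acc (a ∷ b ∷ as) = (acc + a) ∷ descentSet (acc + a) (b ∷ as)

fundOK : List ℕ → ℕ → List ℕ → Bool
fundOK D p [] = true
fundOK D p (a ∷ []) = true
fundOK D p (a ∷ b ∷ is) =
  (if any (λ q → p ≡ᵇ q) D then a <ᵇ b else a ≤ᵇ b) ∧ fundOK D (suc p) (b ∷ is)

fundamental : ℕ → List ℕ → Poly
fundamental n α =
  filter (λ is → fundOK (descentSet 0 α) 1 is Data.Bool.≟ true) (allLists (size-α α) n)

-- Both LSupp(F) and the support of c(F) consist of the labels of the nodes without left
-- child: such a node v has ρ(v) = v, and ρ(v) never has a left child. A node with two
-- children is missing from this set although labels on both sides of it are present, and so
-- is the integer separating two blocks; hence the set is an interval exactly for a single path.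
--
-- On a path whose labels start at j + 1, c(F) is 0^j followed by the composition α whose
-- k parts are the maximal chains of left edges. Listing κ from the root down, the conditions
-- κ(left child) ≥ κ(u) and κ(right child) > κ(u) say that the sequence is weakly increasing
-- within the parts of α and strictly increasing between them, and then κ(v) ≤ ρ(v) amounts to
-- all values being at most k + j, since every later part forces a strictly larger value.
-- Rearranging into inorder is therefore a bijection from the sequences of F_α onto the valid
-- κ, and it permutes each monomial.

module Submission where

open import Defs
open import Data.Nat using (ℕ; zero; suc; _+_; _∸_; _≤_; _<_; z≤n; s≤s; z<s; _≟_; _<?_; _≤ᵇ_; _<ᵇ_; _≡ᵇ_)
open import Data.Nat.Properties
open import Data.Nat.ListAction using (sum)
open import Data.Bool using (Bool; true; false; _∧_; T)
open import Data.Bool.ListAction using (any)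
open import Data.Bool.Properties using (T-≡)
open import Data.List
  using (List; []; _∷_; [_]; _++_; length; lookup; map; filter; concatMap; upTo; cartesianProductWith; splitAt; null)
open import Data.List.Properties
  using (filter-none; filter-some; filter-accept; filter-reject; filter-++; length-++; ++-identityʳ;
         splitAt-defn; take++drop≡id; ∷-injective; ∷ʳ-injective)
open import Data.List.Relation.Unary.All as All using (All; []; _∷_)
open import Data.List.Relation.Unary.All.Properties as All using (¬Any⇒All¬)
open import Data.List.Relation.Unary.Any as Any using (Any; here; there; any?)
open import Data.List.Relation.Unary.Any.Properties using (singleton⁺; singleton⁻)
open import Data.List.Relation.Unary.Linked using (Linked; _∷_)
open import Data.List.Relation.Unary.Linked.Properties using (Linked⇒All)
open import Data.List.Relation.Unary.Unique.Propositional using (Unique; []; _∷_)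
import Data.List.Relation.Unary.Unique.Propositional.Properties as Unique
open import Data.List.Membership.Propositional using (_∈_; find; lose)
open import Data.List.Membership.Propositional.Properties
  using (∈-++⁺ˡ; ∈-++⁺ʳ; ∈-++⁻; ∈-concatMap⁻; ∈-map∘filter⁺; ∈-map∘filter⁻; ∈-filter⁺; ∈-filter⁻;
         ∈-map⁺; ∈-map⁻; ∈-upTo⁺; ∈-upTo⁻; ∈-cartesianProductWith⁺; ∈-cartesianProductWith⁻)
open import Data.List.Membership.Propositional.Properties.WithK using (unique∧set⇒bag)
open import Data.List.Relation.Binary.BagAndSetEquality using (∼bag⇒↭)
open import Data.List.Relation.Binary.Permutation.Propositional as ↭
  using (_↭_; ↭-refl; ↭-sym; ↭-trans; prep; ↭-isEquivalence)
open import Data.List.Relation.Binary.Permutation.Propositional.Properties using (∷↭∷ʳ)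
import Data.List.Relation.Binary.Permutation.Setoid as ↭ₛ
open import Data.List.Relation.Binary.Pointwise using (Pointwise; []; _∷_)
open import Data.Fin using (Fin; toℕ; fromℕ<) renaming (zero to fzero; suc to fsuc)
open import Data.Fin.Properties using (toℕ-fromℕ<)
open import Data.Product using (_×_; _,_; Σ; ∃; ∃₂; proj₁; proj₂)
open import Data.Product.Function.NonDependent.Propositional using (_×-⇔_)
open import Data.Sum using (_⊎_; inj₁; inj₂)
open import Data.Unit using (⊤)
open import Data.Empty using (⊥-elim)
open import Relation.Nullary using (¬_; yes; no; contradiction)
open import Relation.Unary using (Decidable)
open import Relation.Binary using (tri<; tri≈; tri>)
open import Relation.Binary.PropositionalEquality using (_≡_; _≢_; refl; sym; trans; cong; cong₂; subst)
open import Function using (_⇔_; mk⇔; Equivalence)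
import Function.Properties.Equivalence as ⇔

open Equivalence using (to; from)
open Relation.Binary.PropositionalEquality.≡-Reasoning

1+[s+m]+n≡s+[m+1+n] : ∀ s m n → suc (s + m) + n ≡ s + (m + suc n)
1+[s+m]+n≡s+[m+1+n] s m n = begin
  suc (s + m) + n   ≡⟨ cong suc (+-assoc s m n) ⟩
  suc (s + (m + n)) ≡⟨ sym (+-suc s (m + n)) ⟩
  s + suc (m + n)   ≡⟨ cong (s +_) (sym (+-suc m n)) ⟩
  s + (m + suc n)   ∎

∧-≡true⇔ : ∀ {a b} → a ∧ b ≡ true ⇔ (a ≡ true × b ≡ true)
∧-≡true⇔ {true} = mk⇔ (refl ,_) proj₂
∧-≡true⇔ {false} = mk⇔ (λ ()) (λ { (() , _) })

≤ᵇ-≡true⇔ : ∀ {m n} → (m ≤ᵇ n) ≡ true ⇔ m ≤ n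
≤ᵇ-≡true⇔ {m} {n} = ⇔.trans (⇔.sym T-≡) (mk⇔ (≤ᵇ⇒≤ m n) ≤⇒≤ᵇ)

<ᵇ-≡true⇔ : ∀ {m n} → (m <ᵇ n) ≡ true ⇔ m < n
<ᵇ-≡true⇔ {m} {n} = ⇔.trans (⇔.sym T-≡) (mk⇔ (<ᵇ⇒< m n) <⇒<ᵇ)

≢⇒≡ᵇ-false : ∀ {m n} → m ≢ n → (m ≡ᵇ n) ≡ false
≢⇒≡ᵇ-false {m} {n} m≢n with m ≡ᵇ n in eq
... | true = contradiction (≡ᵇ⇒≡ m n (subst T (sym eq) _)) m≢n
... | false = refl

≡⇒≡ᵇ-true : ∀ {m n} → m ≡ n → (m ≡ᵇ n) ≡ true
≡⇒≡ᵇ-true {m} {n} m≡n = to T-≡ (≡⇒≡ᵇ m n m≡n)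

null-≡true : ∀ {A : Set} {xs : List A} → null xs ≡ true → xs ≡ []
null-≡true {xs = []} _ = refl

splitAt-++ : ∀ {A : Set} (xs ys : List A) → splitAt (length xs) (xs ++ ys) ≡ (xs , ys)
splitAt-++ [] ys = refl
splitAt-++ (x ∷ xs) ys = cong (λ p → x ∷ proj₁ p , proj₂ p) (splitAt-++ xs ys)

splitAt-length : ∀ {A : Set} (xs : List A) → splitAt (length xs) xs ≡ (xs , [])
splitAt-length [] = refl
splitAt-length (x ∷ xs) = cong (λ p → x ∷ proj₁ p , proj₂ p) (splitAt-length xs)

splitAt-≡ : ∀ {A : Set} n {xs ys zs : List A} → splitAt n xs ≡ (ys , zs) → xs ≡ ys ++ zs
splitAt-≡ n {xs} eq = trans (sym (take++drop≡id n xs)) (cong (λ p → proj₁ p ++ proj₂ p) (trans (sym (splitAt-defn n xs)) eq))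

length-filter≢0⇔Any : ∀ {A : Set} {P : A → Set} (P? : Decidable P) xs →
  length (filter P? xs) ≢ 0 ⇔ Any P xs
length-filter≢0⇔Any {P = P} P? xs = mk⇔ to′ from′
  where
  to′ : length (filter P? xs) ≢ 0 → Any P xs
  to′ ne with any? P? xs
  ... | yes p = p
  ... | no ¬p = contradiction (cong length (filter-none P? (¬Any⇒All¬ xs ¬p))) ne
  from′ : Any P xs → length (filter P? xs) ≢ 0
  from′ p eq = <-irrefl (sym eq) (filter-some P? p)

Unique-map⁺ : ∀ {A B : Set} {P : A → Set} (f : A → B) {xs} →
  (∀ {x y} → P x → P y → f x ≡ f y → x ≡ y) → All P xs → Unique xs → Unique (map f xs)
Unique-map⁺ f inj [] [] = []
Unique-map⁺ f inj (px ∷ pxs) (x∉xs ∷ unique) =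
  All.map⁺ (All.zipWith (λ (x≢y , py) fx≡fy → x≢y (inj px py fx≡fy)) (x∉xs , pxs)) ∷ Unique-map⁺ f inj pxs unique

map-Pointwise : ∀ {A : Set} {R : A → A → Set} (f : A → A) {xs} → All (λ x → R (f x) x) xs → Pointwise R (map f xs) xs
map-Pointwise f [] = []
map-Pointwise f (r ∷ rs) = r ∷ map-Pointwise f rs

allLists-suc : ∀ n B → allLists (suc n) B ≡ cartesianProductWith _∷_ (map suc (upTo B)) (allLists n B)
allLists-suc n B = concatMap≡cartesianProductWith (map suc (upTo B))
  where
  concatMap≡cartesianProductWith : ∀ xs →
    concatMap (λ x → map (x ∷_) (allLists n B)) xs ≡ cartesianProductWith _∷_ xs (allLists n B)
  concatMap≡cartesianProductWith [] = refl
  concatMap≡cartesianProductWith (x ∷ xs) = cong (map (x ∷_) (allLists n B) ++_) (concatMap≡cartesianProductWith xs)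

InRange : ℕ → ℕ → Set
InRange B x = 1 ≤ x × x ≤ B

∈-allLists⇔ : ∀ n B z → z ∈ allLists n B ⇔ (length z ≡ n × All (InRange B) z)
∈-allLists⇔ n B z = mk⇔ (to′ n z) (from′ n z)
  where
  to′ : ∀ n z → z ∈ allLists n B → length z ≡ n × All (InRange B) z
  to′ zero .[] (here refl) = refl , []
  to′ (suc n) z z∈ with ∈-cartesianProductWith⁻ _∷_ (map suc (upTo B)) (allLists n B) (subst (z ∈_) (allLists-suc n B) z∈)
  ... | x , w , x∈ , w∈ , refl with ∈-map⁻ suc x∈ | to′ n w w∈
  ... | y , y∈ , refl | len , inRange = cong suc len , (s≤s z≤n , ∈-upTo⁻ y∈) ∷ inRange
  from′ : ∀ n z → length z ≡ n × All (InRange B) z → z ∈ allLists n B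
  from′ zero [] _ = here refl
  from′ (suc n) (suc y ∷ z) (len , (_ , y<B) ∷ inRange) =
    subst (_ ∈_) (sym (allLists-suc n B))
      (∈-cartesianProductWith⁺ _∷_ (∈-map⁺ suc (∈-upTo⁺ y<B)) (from′ n z (suc-injective len , inRange)))

allLists-unique : ∀ n B → Unique (allLists n B)
allLists-unique zero B = [] ∷ []
allLists-unique (suc n) B = subst Unique (sym (allLists-suc n B))
  (Unique.cartesianProductWith⁺ _∷_ ∷-injective (Unique.map⁺ suc-injective (Unique.upTo⁺ B)) (allLists-unique n B))

-- LSupp(F) and the support of c(F)

leftEnd≡start : ∀ s t → leftEnd s t ≡ s
leftEnd≡start s leaf = refl
leftEnd≡start s (node leaf r) = refl
leftEnd≡start s (node (node a b) r) = leftEnd≡start s (node a b)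

size-node-pos : ∀ l r → 0 < size (node l r)
size-node-pos l r = subst (0 <_) (sym (+-suc (size l) (size r))) z<s

data LSuppTree : ℕ → Tree → ℕ → Set where
  root  : ∀ {s r} → LSuppTree s (node leaf r) s
  left  : ∀ {s l r i} → LSuppTree s l i → LSuppTree s (node l r) i
  right : ∀ {s l r i} → LSuppTree (suc (s + size l)) r i → LSuppTree s (node l r) i

LSuppTree-start : ∀ s l r → LSuppTree s (node l r) s
LSuppTree-start s leaf r = root
LSuppTree-start s (node a b) r = left (LSuppTree-start s a b)

LSuppTree-bounds : ∀ {s t i} → LSuppTree s t i → s ≤ i × i < s + size t
LSuppTree-bounds {s} {node leaf r} root = ≤-refl , m<m+n s (size-node-pos leaf r)
LSuppTree-bounds {s} {node l r} (left p) with LSuppTree-bounds p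
... | s≤i , i<s+l = s≤i , <-≤-trans i<s+l (+-monoʳ-≤ s (m≤m+n (size l) (suc (size r))))
LSuppTree-bounds {s} {node l r} {i} (right p) with LSuppTree-bounds p
... | s+l<i , i<s+l+r =
  ≤-trans (m≤m+n s (size l)) (<⇒≤ s+l<i) , subst (i <_) (1+[s+m]+n≡s+[m+1+n] s (size l) (size r)) i<s+l+r

LSuppTree⇒node : ∀ {s t i} → LSuppTree s t i →
  ∃ λ v → v ∈ nodesT s t × hasLeft v ≡ false × label v ≡ i × rho v ≡ i
LSuppTree⇒node {s} {node leaf r} root = _ , ∈-++⁺ʳ [] (here refl) , refl , +-identityʳ s , refl
LSuppTree⇒node (left p) with LSuppTree⇒node p
... | v , v∈ , h , lab , rh = v , ∈-++⁺ˡ v∈ , h , lab , rh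
LSuppTree⇒node {s} {node l r} (right p) with LSuppTree⇒node p
... | v , v∈ , h , lab , rh = v , ∈-++⁺ʳ (nodesT s l) (there v∈) , h , lab , rh

rho∈LSuppTree : ∀ {s t v} → v ∈ nodesT s t → LSuppTree s t (rho v)
rho∈LSuppTree {s} {node l r} v∈ with ∈-++⁻ (nodesT s l) v∈
... | inj₁ v∈l = left (rho∈LSuppTree v∈l)
... | inj₂ (here refl) = subst (LSuppTree s (node l r)) (sym (leftEnd≡start s (node l r))) (LSuppTree-start s l r)
... | inj₂ (there v∈r) = right (rho∈LSuppTree v∈r)

noLeftChild∈LSuppTree : ∀ {s t v} → v ∈ nodesT s t → hasLeft v ≡ false → LSuppTree s t (label v)
noLeftChild∈LSuppTree {s} {node l r} v∈ h with ∈-++⁻ (nodesT s l) v∈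
... | inj₁ v∈l = left (noLeftChild∈LSuppTree v∈l h)
... | inj₂ (there v∈r) = right (noLeftChild∈LSuppTree v∈r h)
noLeftChild∈LSuppTree {s} {node leaf r} v∈ h | inj₂ (here refl) = subst (LSuppTree s _) (sym (+-identityʳ s)) root
noLeftChild∈LSuppTree {s} {node (node _ _) r} v∈ () | inj₂ (here refl)

LSuppBlocks : List Block → ℕ → Set
LSuppBlocks bs i = Any (λ b → LSuppTree (proj₁ b) (proj₂ b) i) bs

blockNodes : List Block → List NodeInfo
blockNodes = concatMap (λ b → nodesT (proj₁ b) (proj₂ b))

LSuppBlocks⇒node : ∀ {bs i} → LSuppBlocks bs i →
  ∃ λ v → v ∈ blockNodes bs × hasLeft v ≡ false × label v ≡ i × rho v ≡ i
LSuppBlocks⇒node {b ∷ _} (here p) with LSuppTree⇒node p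
... | v , v∈ , rest = v , ∈-++⁺ˡ v∈ , rest
LSuppBlocks⇒node {b ∷ _} (there p) with LSuppBlocks⇒node p
... | v , v∈ , rest = v , ∈-++⁺ʳ (nodesT (proj₁ b) (proj₂ b)) v∈ , rest

rho∈LSuppBlocks : ∀ {bs v} → v ∈ blockNodes bs → LSuppBlocks bs (rho v)
rho∈LSuppBlocks {bs} v∈ = Any.map rho∈LSuppTree (∈-concatMap⁻ _ {bs} v∈)

noLeftChild∈LSuppBlocks : ∀ {bs v} → v ∈ blockNodes bs → hasLeft v ≡ false → LSuppBlocks bs (label v)
noLeftChild∈LSuppBlocks {bs} v∈ h = Any.map (λ v∈t → noLeftChild∈LSuppTree v∈t h) (∈-concatMap⁻ _ {bs} v∈)

LSuppBlocks-positive : ∀ {bs i} → All (λ b → 1 ≤ proj₁ b) bs → LSuppBlocks bs i → 1 ≤ i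
LSuppBlocks-positive (1≤s ∷ _) (here p) = ≤-trans 1≤s (proj₁ (LSuppTree-bounds p))
LSuppBlocks-positive (_ ∷ ps) (there p) = LSuppBlocks-positive ps p

SuppC⇔LSuppBlocks : ∀ F i → SuppC F i ⇔ LSuppBlocks (blocks F) i
SuppC⇔LSuppBlocks F i = mk⇔ to′ from′
  where
  to′ : SuppC F i → LSuppBlocks (blocks F) i
  to′ (_ , cᵢ≢0) with find (to (length-filter≢0⇔Any (λ v → rho v ≟ i) (nodes F)) cᵢ≢0)
  ... | v , v∈ , refl = rho∈LSuppBlocks v∈
  from′ : LSuppBlocks (blocks F) i → SuppC F i
  from′ p with LSuppBlocks⇒node p
  ... | v , v∈ , _ , _ , ρv≡i =
    LSuppBlocks-positive (positive F) p ,
    from (length-filter≢0⇔Any (λ v → rho v ≟ i) (nodes F)) (lose v∈ ρv≡i)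

InLSupp⇔LSuppBlocks : ∀ F i → InLSupp F i ⇔ LSuppBlocks (blocks F) i
InLSupp⇔LSuppBlocks F i = mk⇔ to′ from′
  where
  noLeft? : Decidable (λ v → hasLeft v ≡ false)
  noLeft? v = hasLeft v Data.Bool.≟ false
  to′ : InLSupp F i → LSuppBlocks (blocks F) i
  to′ i∈ with ∈-map∘filter⁻ label noLeft? i∈
  ... | v , v∈ , refl , h = noLeftChild∈LSuppBlocks v∈ h
  from′ : LSuppBlocks (blocks F) i → InLSupp F i
  from′ p with LSuppBlocks⇒node p
  ... | v , v∈ , h , refl , _ = ∈-map∘filter⁺ label noLeft? (v , v∈ , refl , h)

IsInterval-cong : ∀ {P Q : ℕ → Set} → (∀ i → P i ⇔ Q i) → IsInterval P ⇔ IsInterval Q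
IsInterval-cong P⇔Q = mk⇔ (transport P⇔Q) (transport (λ i → ⇔.sym (P⇔Q i)))
  where
  transport : ∀ {P Q : ℕ → Set} → (∀ i → P i ⇔ Q i) → IsInterval P → IsInterval Q
  transport P⇔Q (a , b , 1≤a , a≤b , P⇔[a,b]) = a , b , 1≤a , a≤b , λ i → ⇔.trans (⇔.sym (P⇔Q i)) (P⇔[a,b] i)

-- Linearity and intervals

incrHead : List ℕ → List ℕ
incrHead [] = []
incrHead (a ∷ as) = suc a ∷ as

length-incrHead : ∀ as → length (incrHead as) ≡ length as
length-incrHead [] = refl
length-incrHead (a ∷ as) = refl

incrHead-positive : ∀ {as} → All (1 ≤_) as → All (1 ≤_) (incrHead as)
incrHead-positive [] = []
incrHead-positive (_ ∷ ps) = s≤s z≤n ∷ ps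

-- c(t) of a path t, read as a composition: one part per maximal chain of left edges.
pathComposition : Tree → List ℕ
pathComposition leaf = []
pathComposition (node leaf r) = 1 ∷ pathComposition r
pathComposition (node (node a b) leaf) = incrHead (pathComposition (node a b))
pathComposition (node (node _ _) (node _ _)) = []

pathComposition-nonempty : ∀ {l r} → IsPath (node l r) →
  ∃₂ λ a as → pathComposition (node l r) ≡ suc a ∷ as
pathComposition-nonempty {leaf} {r} _ = 0 , pathComposition r , refl
pathComposition-nonempty {node a b} {leaf} path with pathComposition-nonempty {a} {b} path
... | x , xs , eq = suc x , xs , cong incrHead eq

pathComposition-positive : ∀ t → IsPath t → All (1 ≤_) (pathComposition t)
pathComposition-positive leaf _ = []
pathComposition-positive (node leaf r) path = s≤s z≤n ∷ pathComposition-positive r path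
pathComposition-positive (node (node a b) leaf) path = incrHead-positive (pathComposition-positive (node a b) path)

LSuppTree-path : ∀ {s t i} → IsPath t → LSuppTree s t i ⇔ (s ≤ i × i < s + length (pathComposition t))
LSuppTree-path {i = i} path = mk⇔ (to′ path) (from′ path)
  where
  to′ : ∀ {s t} → IsPath t → LSuppTree s t i → s ≤ i × i < s + length (pathComposition t)
  to′ {s} {node leaf r} _ root = ≤-refl , m<m+n s z<s
  to′ {s} {node leaf r} path (right p) with to′ path p
  ... | s<i , i<end = ≤-trans (m≤m+n s 0) (<⇒≤ s<i) , subst (i <_) (1+[s+m]+n≡s+[m+1+n] s 0 _) i<end
  to′ {s} {node (node a b) leaf} path (left p) with to′ path p
  ... | s≤i , i<end = s≤i , subst (λ n → i < s + n) (sym (length-incrHead (pathComposition (node a b)))) i<end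
  from′ : ∀ {s t} → IsPath t → s ≤ i × i < s + length (pathComposition t) → LSuppTree s t i
  from′ {s} {leaf} _ (s≤i , i<s+0) = contradiction (subst (i <_) (+-identityʳ s) i<s+0) (≤⇒≯ s≤i)
  from′ {s} {node leaf r} path (s≤i , i<end) with m≤n⇒m<n∨m≡n s≤i
  ... | inj₂ refl = root
  ... | inj₁ s<i = right (from′ path (subst (_≤ i) (cong suc (sym (+-identityʳ s))) s<i ,
                                     subst (i <_) (sym (1+[s+m]+n≡s+[m+1+n] s 0 _)) i<end))
  from′ {s} {node (node a b) leaf} path (s≤i , i<end) =
    left (from′ path (s≤i , subst (λ n → i < s + n) (length-incrHead (pathComposition (node a b))) i<end))

record HasGap (P : ℕ → Set) : Set where
  constructor gap
  field
    {x y z} : ℕ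
    x<y : x < y
    y<z : y < z
    Px : P x
    ¬Py : ¬ P y
    Pz : P z

IsInterval⇒¬HasGap : ∀ {P} → IsInterval P → ¬ HasGap P
IsInterval⇒¬HasGap (a , b , _ , _ , P⇔[a,b]) (gap x<y y<z Px ¬Py Pz) =
  ¬Py (from (P⇔[a,b] _) (≤-trans a≤x (<⇒≤ x<y) , ≤-trans (<⇒≤ y<z) z≤b))
  where
  a≤x = proj₁ (to (P⇔[a,b] _) Px)
  z≤b = proj₂ (to (P⇔[a,b] _) Pz)

IsPath⊎HasGap : ∀ s t → IsPath t ⊎ HasGap (LSuppTree s t)
IsPath⊎HasGap s leaf = inj₁ _
IsPath⊎HasGap s (node leaf r) with IsPath⊎HasGap (suc (s + 0)) r
... | inj₁ path = inj₁ path
... | inj₂ (gap x<y y<z Px ¬Py Pz) = inj₂ (gap x<y y<z (right Px) ¬Py′ (right Pz))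
  where
  ¬Py′ : ¬ LSuppTree s (node leaf r) _
  ¬Py′ root = contradiction (≤-trans (m≤m+n (suc s) 0) (proj₁ (LSuppTree-bounds Px))) (≤⇒≯ (<⇒≤ x<y))
  ¬Py′ (right p) = ¬Py p
IsPath⊎HasGap s (node (node a b) leaf) with IsPath⊎HasGap s (node a b)
... | inj₁ path = inj₁ path
... | inj₂ (gap x<y y<z Px ¬Py Pz) = inj₂ (gap x<y y<z (left Px) ¬Py′ (left Pz))
  where
  ¬Py′ : ¬ LSuppTree s (node (node a b) leaf) _
  ¬Py′ (left p) = ¬Py p
IsPath⊎HasGap s (node (node a b) (node c d)) =
  inj₂ (gap (m<m+n s (size-node-pos a b)) (n<1+n _) (left (LSuppTree-start s a b)) ¬Py (right (LSuppTree-start _ c d)))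
  where
  ¬Py : ¬ LSuppTree s (node (node a b) (node c d)) (s + size (node a b))
  ¬Py (left p) = <-irrefl refl (proj₂ (LSuppTree-bounds p))
  ¬Py (right p) = <-irrefl refl (proj₁ (LSuppTree-bounds p))

LSuppBlocks-below : ∀ {bs y} → All (λ b → y < proj₁ b) bs → ¬ LSuppBlocks bs y
LSuppBlocks-below (y<s ∷ _) (here p) = <⇒≱ y<s (proj₁ (LSuppTree-bounds p))
LSuppBlocks-below (_ ∷ y<ss) (there p) = LSuppBlocks-below y<ss p

Separated-trans : ∀ {b b′ b″} → Separated b b′ → Separated b′ b″ → Separated b b″
Separated-trans {s , t} {s′ , t′} b<b′ b′<b″ = ≤-trans b<b′ (≤-trans (m≤m+n s′ (size t′)) (<⇒≤ b′<b″))

twoBlocks-HasGap : ∀ {b b′ bs} → NonEmptyTree (proj₂ b) → NonEmptyTree (proj₂ b′) →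
  Linked Separated (b ∷ b′ ∷ bs) → HasGap (LSuppBlocks (b ∷ b′ ∷ bs))
twoBlocks-HasGap {s , node l r} {s′ , node l′ r′} _ _ (b<b′ ∷ sep) =
  gap (m<m+n s (size-node-pos l r)) b<b′ (here (LSuppTree-start s l r)) ¬Py (there (here (LSuppTree-start s′ l′ r′)))
  where
  ¬Py : ¬ LSuppBlocks _ (s + size (node l r))
  ¬Py (here p) = <-irrefl refl (proj₂ (LSuppTree-bounds p))
  ¬Py (there p) =
    LSuppBlocks-below (Linked⇒All (λ {b b′ b″} → Separated-trans {b} {b′} {b″}) {v = s , node l r} b<b′ sep) p

IsLinear⇔IsInterval-LSuppBlocks : ∀ F → IsLinear F ⇔ IsInterval (LSuppBlocks (blocks F))
IsLinear⇔IsInterval-LSuppBlocks (indFor _ nonEmpty pos sep) = mk⇔ (to′ nonEmpty pos) (from′ nonEmpty sep)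
  where
  to′ : ∀ {bs} → All (λ b → NonEmptyTree (proj₂ b)) bs → All (λ b → 1 ≤ proj₁ b) bs →
    Σ Block (λ b → bs ≡ [ b ] × IsPath (proj₂ b)) → IsInterval (LSuppBlocks bs)
  to′ (_ ∷ []) (1≤s ∷ []) ((s , node l r) , refl , path) with pathComposition-nonempty {l} {r} path
  ... | _ , as , eq = s , s + length as , 1≤s , m≤m+n s (length as) , λ i →
    ⇔.trans (mk⇔ singleton⁻ singleton⁺) (⇔.trans (LSuppTree-path path) (mk⇔
      (λ (s≤i , i<end) → s≤i , ≤-pred (subst (i <_) end≡ i<end))
      (λ (s≤i , i≤last) → s≤i , subst (i <_) (sym end≡) (s≤s i≤last))))
    where
    end≡ : s + length (pathComposition (node l r)) ≡ suc (s + length as)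
    end≡ = trans (cong (λ c → s + length c) eq) (+-suc s (length as))
  from′ : ∀ {bs} → All (λ b → NonEmptyTree (proj₂ b)) bs → Linked Separated bs →
    IsInterval (LSuppBlocks bs) → Σ Block (λ b → bs ≡ [ b ] × IsPath (proj₂ b))
  from′ [] _ (a , _ , _ , a≤b , P⇔[a,b]) with from (P⇔[a,b] a) (≤-refl , a≤b)
  ... | ()
  from′ {(s , t) ∷ []} _ _ interval with IsPath⊎HasGap s t
  ... | inj₁ path = (s , t) , refl , path
  ... | inj₂ (gap x<y y<z Px ¬Py Pz) =
    ⊥-elim (IsInterval⇒¬HasGap interval (gap x<y y<z (here Px) (λ p → ¬Py (singleton⁻ p)) (here Pz)))
  from′ (ne ∷ ne′ ∷ _) sep interval = ⊥-elim (IsInterval⇒¬HasGap interval (twoBlocks-HasGap ne ne′ sep))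

-- The sequence c(F) of a linear tree

entry : List ℕ → ℕ → ℕ
entry [] _ = 0
entry (a ∷ as) zero = a
entry (a ∷ as) (suc d) = entry as d

entry-lookup : ∀ as (k : Fin (length as)) → entry as (toℕ k) ≡ lookup as k
entry-lookup (a ∷ as) fzero = refl
entry-lookup (a ∷ as) (fsuc k) = entry-lookup as k

entry-beyond : ∀ as {d} → length as ≤ d → entry as d ≡ 0
entry-beyond [] _ = refl
entry-beyond (a ∷ as) (s≤s len≤d) = entry-beyond as len≤d

≡-by-entries : ∀ {as bs} → All (1 ≤_) as → All (1 ≤_) bs → (∀ d → entry as d ≡ entry bs d) → as ≡ bs
≡-by-entries [] [] _ = refl
≡-by-entries [] (1≤b ∷ _) eq = contradiction (eq 0) (<⇒≢ 1≤b)
≡-by-entries (1≤a ∷ _) [] eq = contradiction (sym (eq 0)) (<⇒≢ 1≤a)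
≡-by-entries (_ ∷ as) (_ ∷ bs) eq = cong₂ _∷_ (eq 0) (≡-by-entries as bs (λ d → eq (suc d)))

record HasShape (c : ℕ → ℕ) (j : ℕ) (α : List ℕ) : Set where
  constructor shape
  field
    leading : ∀ i → 1 ≤ i → i ≤ j → c i ≡ 0
    rest    : ∀ d → c (j + suc d) ≡ entry α d

HasShape-intro : ∀ {c j α} →
  (∀ i → 1 ≤ i → i ≤ j → c i ≡ 0) →
  (∀ (k : Fin (length α)) → c (j + suc (toℕ k)) ≡ lookup α k) →
  (∀ i → j + length α < i → c i ≡ 0) →
  HasShape c j α
HasShape-intro {c} {j} {α} leading parts trailing = shape leading rest
  where
  rest : ∀ d → c (j + suc d) ≡ entry α d
  rest d with d <? length α
  ... | yes d<len = begin
    c (j + suc d)                    ≡⟨ cong (λ e → c (j + suc e)) (sym (toℕ-fromℕ< d<len)) ⟩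
    c (j + suc (toℕ (fromℕ< d<len))) ≡⟨ parts (fromℕ< d<len) ⟩
    lookup α (fromℕ< d<len)          ≡⟨ sym (entry-lookup α (fromℕ< d<len)) ⟩
    entry α (toℕ (fromℕ< d<len))     ≡⟨ cong (entry α) (toℕ-fromℕ< d<len) ⟩
    entry α d                        ∎
  ... | no d≮len = trans (trailing (j + suc d) (+-monoʳ-< j (s≤s (≮⇒≥ d≮len)))) (sym (entry-beyond α (≮⇒≥ d≮len)))

module _ {c : ℕ → ℕ} where
  open HasShape

  HasShape-first : ∀ {j a as} → HasShape c j (a ∷ as) → c (suc j) ≡ a
  HasShape-first {j} {a} sh = subst (λ i → c i ≡ a) (+-comm j 1) (rest sh 0)

  HasShape-[] : ∀ {j i} → HasShape c j [] → j < i → c i ≡ 0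
  HasShape-[] {j} {i} sh j<i = subst (λ k → c k ≡ 0) (trans (+-suc j _) (m+[n∸m]≡n j<i)) (rest sh (i ∸ suc j))

  HasShape-unique : ∀ {j j′ α b bs} → All (1 ≤_) α → All (1 ≤_) (b ∷ bs) →
    HasShape c j α → HasShape c j′ (b ∷ bs) → j ≡ j′ × α ≡ b ∷ bs
  HasShape-unique {j} {j′} αpos βpos@(1≤b ∷ _) sh sh′ with <-cmp j j′ | αpos
  ... | tri≈ _ refl _ | _ = refl , ≡-by-entries αpos βpos (λ d → trans (sym (rest sh d)) (rest sh′ d))
  ... | tri> _ _ j′<j | _ =
    contradiction (trans (sym (leading sh (suc j′) (s≤s z≤n) j′<j)) (HasShape-first sh′)) (<⇒≢ 1≤b)
  ... | tri< j<j′ _ _ | [] =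
    contradiction (trans (sym (HasShape-[] sh (m<n⇒m<1+n j<j′))) (HasShape-first sh′)) (<⇒≢ 1≤b)
  ... | tri< j<j′ _ _ | 1≤a ∷ _ =
    contradiction (trans (sym (leading sh′ (suc j) (s≤s z≤n) j<j′)) (HasShape-first sh)) (<⇒≢ 1≤a)

countRho : List NodeInfo → ℕ → ℕ
countRho vs i = length (filter (λ v → rho v ≟ i) vs)

countRho-++ : ∀ us vs i → countRho (us ++ vs) i ≡ countRho us i + countRho vs i
countRho-++ us vs i = trans (cong length (filter-++ (λ v → rho v ≟ i) us vs)) (length-++ (filter (λ v → rho v ≟ i) us))

countRho-here : ∀ {v vs i} → rho v ≡ i → countRho (v ∷ vs) i ≡ suc (countRho vs i)
countRho-here {i = i} eq = cong length (filter-accept (λ v → rho v ≟ i) eq)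

countRho-skip : ∀ {v vs i} → rho v ≢ i → countRho (v ∷ vs) i ≡ countRho vs i
countRho-skip {i = i} neq = cong length (filter-reject (λ v → rho v ≟ i) neq)

countRho-below : ∀ {s i} t → i < s → countRho (nodesT s t) i ≡ 0
countRho-below {s} {i} t i<s = cong length (filter-none (λ v → rho v ≟ i) (All.tabulate ρv≢i))
  where
  ρv≢i : ∀ {v} → v ∈ nodesT s t → rho v ≢ i
  ρv≢i v∈ refl = <⇒≱ i<s (proj₁ (LSuppTree-bounds (rho∈LSuppTree {t = t} v∈)))

countRho-path : ∀ s t → IsPath t → ∀ d → countRho (nodesT s t) (s + d) ≡ entry (pathComposition t) d
countRho-path s leaf _ d = refl
countRho-path s (node leaf r) path zero =
  trans (countRho-here (sym (+-identityʳ s))) (cong suc (countRho-below r (n<1+n (s + 0))))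
countRho-path s (node leaf r) path (suc d) = begin
  countRho (nodesT s (node leaf r)) (s + suc d)       ≡⟨ countRho-skip (<⇒≢ (m<m+n s z<s)) ⟩
  countRho (nodesT (suc (s + 0)) r) (s + suc d)       ≡⟨ cong (countRho (nodesT (suc (s + 0)) r)) (sym (1+[s+m]+n≡s+[m+1+n] s 0 d)) ⟩
  countRho (nodesT (suc (s + 0)) r) (suc (s + 0) + d) ≡⟨ countRho-path (suc (s + 0)) r path d ⟩
  entry (pathComposition r) d                          ∎
countRho-path s (node (node a b) leaf) path d
  with pathComposition (node a b) | pathComposition-nonempty {a} {b} path | countRho-path s (node a b) path
... | _ | x , xs , refl | ih = begin
  countRho (nodesT s (node a b) ++ [ v ]) (s + d)              ≡⟨ countRho-++ (nodesT s (node a b)) [ v ] (s + d) ⟩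
  countRho (nodesT s (node a b)) (s + d) + countRho [ v ] (s + d) ≡⟨ cong (_+ countRho [ v ] (s + d)) (ih d) ⟩
  entry (suc x ∷ xs) d + countRho [ v ] (s + d)                  ≡⟨ lastNode d ⟩
  entry (suc (suc x) ∷ xs) d                                     ∎
  where
  v = info (s + size (node a b)) (leftEnd s (node a b)) true
  ρv≡s : rho v ≡ s
  ρv≡s = leftEnd≡start s (node a b)
  lastNode : ∀ d → entry (suc x ∷ xs) d + countRho [ v ] (s + d) ≡ entry (suc (suc x) ∷ xs) d
  lastNode zero = trans (cong (suc x +_) (countRho-here (trans ρv≡s (sym (+-identityʳ s))))) (+-comm (suc x) 1)
  lastNode (suc d) =
    trans (cong (entry xs d +_) (countRho-skip (λ eq → <⇒≢ (m<m+n s z<s) (trans (sym ρv≡s) eq)))) (+-identityʳ _)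

pathBlock-HasShape : ∀ {j t} F → blocks F ≡ [ (suc j , t) ] → IsPath t → HasShape (cF F) j (pathComposition t)
pathBlock-HasShape {j} {t} (indFor _ _ _ _) refl path = shape leading rest
  where
  cF≡ : ∀ i → countRho (nodesT (suc j) t ++ []) i ≡ countRho (nodesT (suc j) t) i
  cF≡ i = cong (λ vs → countRho vs i) (++-identityʳ (nodesT (suc j) t))
  leading : ∀ i → 1 ≤ i → i ≤ j → countRho (nodesT (suc j) t ++ []) i ≡ 0
  leading i _ i≤j = trans (cF≡ i) (countRho-below t (s≤s i≤j))
  rest : ∀ d → countRho (nodesT (suc j) t ++ []) (j + suc d) ≡ entry (pathComposition t) d
  rest d = trans (cF≡ (j + suc d)) (trans (cong (countRho (nodesT (suc j) t)) (+-suc j d)) (countRho-path (suc j) t path d))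

-- Valid labellings κ

record NodeSplit (lo s : ℕ) (l r : Tree) (κ : List ℕ) : Set where
  constructor nodeSplit
  field
    {κl} : List ℕ
    {k}  : ℕ
    {κr} : List ℕ
    κ≡  : κ ≡ κl ++ k ∷ κr
    lo≤k : lo ≤ k
    k≤s  : k ≤ s
    okl  : okT k s l κl ≡ true
    okr  : okT (suc k) (suc (s + size l)) r κr ≡ true

okT-node⇒ : ∀ {lo s l r κ} → okT lo s (node l r) κ ≡ true → NodeSplit lo s l r κ
okT-node⇒ {lo} {s} {l} {r} {κ} ok with splitAt (size l) κ in eq
... | κl , k ∷ κr with to ∧-≡true⇔ ok
... | lo≤k , ok′ with to ∧-≡true⇔ ok′
... | k≤ρ , ok″ with to ∧-≡true⇔ ok″
... | okl , okr = nodeSplit (splitAt-≡ (size l) eq) (to ≤ᵇ-≡true⇔ lo≤k)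
        (subst (_ ≤_) (leftEnd≡start s (node l r)) (to ≤ᵇ-≡true⇔ k≤ρ)) okl okr

okT-length : ∀ {lo s} t {κ} → okT lo s t κ ≡ true → length κ ≡ size t
okT-length leaf ok = cong length (null-≡true ok)
okT-length {lo} {s} (node l r) {κ} ok with okT-node⇒ {lo} {s} {l} {r} {κ} ok
... | nodeSplit {κl} {k} {κr} refl _ _ okl okr =
  trans (length-++ κl) (cong₂ (λ m n → m + suc n) (okT-length l okl) (okT-length r okr))

okT-node⇐ : ∀ {lo s l r κ} → NodeSplit lo s l r κ → okT lo s (node l r) κ ≡ true
okT-node⇐ {lo} {s} {l} {r} (nodeSplit {κl} {k} {κr} refl lo≤k k≤s okl okr)
  rewrite subst (λ n → splitAt n (κl ++ k ∷ κr) ≡ (κl , k ∷ κr)) (okT-length l okl) (splitAt-++ κl (k ∷ κr)) =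
  from ∧-≡true⇔ (from ≤ᵇ-≡true⇔ lo≤k ,
    from ∧-≡true⇔ (from ≤ᵇ-≡true⇔ (subst (k ≤_) (sym (leftEnd≡start s (node l r))) k≤s) ,
      from ∧-≡true⇔ (okl , okr)))

okT-bounds : ∀ {lo s} t {κ} → okT lo s t κ ≡ true → All (λ k → lo ≤ k × k ≤ s + size t) κ
okT-bounds leaf {[]} _ = []
okT-bounds {lo} {s} (node l r) {κ} ok with okT-node⇒ {lo} {s} {l} {r} {κ} ok
... | nodeSplit {κl} {k} {κr} refl lo≤k k≤s okl okr =
  All.++⁺ (All.map (λ (k≤x , x≤end) → ≤-trans lo≤k k≤x , ≤-trans x≤end (+-monoʳ-≤ s (m≤m+n (size l) _)))
                   (okT-bounds l okl))
          ((lo≤k , ≤-trans k≤s (m≤m+n s _)) ∷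
           All.map (λ (k<x , x≤end) → ≤-trans lo≤k (<⇒≤ k<x) ,
                                      ≤-trans x≤end (≤-reflexive (1+[s+m]+n≡s+[m+1+n] s (size l) (size r))))
                   (okT-bounds r okr))

okF-singleton⇔ : ∀ s t κ → okF [ (s , t) ] κ ≡ true ⇔ okT 1 s t κ ≡ true
okF-singleton⇔ s t κ = mk⇔ to′ from′
  where
  to′ : okF [ (s , t) ] κ ≡ true → okT 1 s t κ ≡ true
  to′ ok with splitAt (size t) κ in eq
  ... | κ₁ , κ₂ with to ∧-≡true⇔ ok
  ... | ok₁ , κ₂-null = subst (λ κ′ → okT 1 s t κ′ ≡ true) (sym κ≡κ₁) ok₁
    where
    κ≡κ₁ : κ ≡ κ₁
    κ≡κ₁ = trans (splitAt-≡ (size t) eq) (trans (cong (κ₁ ++_) (null-≡true κ₂-null)) (++-identityʳ κ₁))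
  from′ : okT 1 s t κ ≡ true → okF [ (s , t) ] κ ≡ true
  from′ ok rewrite subst (λ n → splitAt n κ ≡ (κ , [])) (okT-length t ok) (splitAt-length κ) =
    from ∧-≡true⇔ (ok , refl)

∈-forestPoly⇔okT : ∀ {s t κ} F → blocks F ≡ [ (s , t) ] → κ ∈ forestPoly F ⇔ okT 1 s t κ ≡ true
∈-forestPoly⇔okT {s} {t} {κ} (indFor _ _ _ _) refl = mk⇔ to′ from′
  where
  okF? : Decidable (λ κ → okF [ (s , t) ] κ ≡ true)
  okF? κ = okF [ (s , t) ] κ Data.Bool.≟ true
  to′ : κ ∈ filter okF? (allLists (size t + 0) (s + size t + 0)) → okT 1 s t κ ≡ true
  to′ κ∈ = to (okF-singleton⇔ s t κ) (proj₂ (∈-filter⁻ okF? {xs = allLists (size t + 0) (s + size t + 0)} κ∈))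
  from′ : okT 1 s t κ ≡ true → κ ∈ filter okF? (allLists (size t + 0) (s + size t + 0))
  from′ ok = ∈-filter⁺ okF? (from (∈-allLists⇔ _ _ κ)
    (trans (okT-length t ok) (sym (+-identityʳ _)) ,
     All.map (λ (1≤k , k≤end) → 1≤k , ≤-trans k≤end (≤-reflexive (sym (+-identityʳ _)))) (okT-bounds t ok)))
    (from (okF-singleton⇔ s t κ) ok)

-- PathLabelling lo s t z: z lists a valid κ on the path t (labelled from s)
-- from the root downwards, the root value being at least lo.
data PathLabelling : ℕ → ℕ → Tree → List ℕ → Set where
  stop    : ∀ {lo s} → PathLabelling lo s leaf []
  goRight : ∀ {lo s k r z} → lo ≤ k → k ≤ s →
            PathLabelling (suc k) (suc (s + 0)) r z → PathLabelling lo s (node leaf r) (k ∷ z)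
  goLeft  : ∀ {lo s k a b z} → lo ≤ k → k ≤ s →
            PathLabelling k s (node a b) z → PathLabelling lo s (node (node a b) leaf) (k ∷ z)

inorder : Tree → List ℕ → List ℕ
inorder (node leaf r) (k ∷ z) = k ∷ inorder r z
inorder (node (node a b) leaf) (k ∷ z) = inorder (node a b) z ++ [ k ]
inorder _ _ = []

PathLabelling⇒okT : ∀ {lo s t z} → PathLabelling lo s t z → okT lo s t (inorder t z) ≡ true
PathLabelling⇒okT stop = refl
PathLabelling⇒okT (goRight {r = r} lo≤k k≤s p) =
  okT-node⇐ {l = leaf} {r} (nodeSplit {κl = []} refl lo≤k k≤s refl (PathLabelling⇒okT p))
PathLabelling⇒okT (goLeft {a = a} {b} lo≤k k≤s p) =
  okT-node⇐ {l = node a b} {leaf} (nodeSplit {κr = []} refl lo≤k k≤s (PathLabelling⇒okT p) refl)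

LabelledInorder : ℕ → ℕ → Tree → List ℕ → Set
LabelledInorder lo s t κ = ∃ λ z → PathLabelling lo s t z × inorder t z ≡ κ

okT⇒PathLabelling : ∀ {lo s} t {κ} → IsPath t → okT lo s t κ ≡ true → LabelledInorder lo s t κ
okT⇒PathLabelling leaf {κ} _ ok = [] , stop , sym (null-≡true {xs = κ} ok)
okT⇒PathLabelling (node leaf r) path ok = viaRight (okT⇒PathLabelling r path) (okT-node⇒ ok)
  where
  viaRight : ∀ {lo s κ} → (∀ {lo′ s′ κ′} → okT lo′ s′ r κ′ ≡ true → LabelledInorder lo′ s′ r κ′) →
    NodeSplit lo s leaf r κ → LabelledInorder lo s (node leaf r) κ
  viaRight ih (nodeSplit {[]} refl lo≤k k≤s _ okr) with ih okr
  ... | z , p , refl = _ ∷ z , goRight lo≤k k≤s p , refl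
okT⇒PathLabelling (node (node a b) leaf) path ok = viaLeft (okT⇒PathLabelling (node a b) path) (okT-node⇒ ok)
  where
  viaLeft : ∀ {lo s κ} → (∀ {lo′ s′ κ′} → okT lo′ s′ (node a b) κ′ ≡ true → LabelledInorder lo′ s′ (node a b) κ′) →
    NodeSplit lo s (node a b) leaf κ → LabelledInorder lo s (node (node a b) leaf) κ
  viaLeft ih (nodeSplit {κr = []} refl lo≤k k≤s okl _) with ih okl
  ... | z , p , refl = _ ∷ z , goLeft lo≤k k≤s p , refl

inorder-↭ : ∀ {lo s t z} → PathLabelling lo s t z → inorder t z ↭ z
inorder-↭ stop = ↭-refl
inorder-↭ (goRight {k = k} _ _ p) = prep k (inorder-↭ p)
inorder-↭ (goLeft {k = k} {a} {b} {z} _ _ p) = ↭-trans (↭-sym (∷↭∷ʳ k (inorder (node a b) z))) (prep k (inorder-↭ p))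

inorder-injective : ∀ {lo lo′ s t z z′} → PathLabelling lo s t z → PathLabelling lo′ s t z′ →
  inorder t z ≡ inorder t z′ → z ≡ z′
inorder-injective stop stop _ = refl
inorder-injective (goRight _ _ p) (goRight _ _ p′) eq with ∷-injective eq
... | refl , eq′ = cong (_ ∷_) (inorder-injective p p′ eq′)
inorder-injective (goLeft {a = a} {b} {z} _ _ p) (goLeft {z = z′} _ _ p′) eq
  with ∷ʳ-injective (inorder (node a b) z) (inorder (node a b) z′) eq
... | eq′ , refl = cong (_ ∷_) (inorder-injective p p′ eq′)

-- Fundamental quasisymmetric polynomials

data FundSeq (B : ℕ) : ℕ → List ℕ → List ℕ → Set where
  []     : ∀ {lo} → FundSeq B lo [] []
  close  : ∀ {lo k as z} → lo ≤ k → k ≤ B → FundSeq B (suc k) as z → FundSeq B lo (1 ∷ as) (k ∷ z)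
  extend : ∀ {lo k a as z} → lo ≤ k → k ≤ B → FundSeq B k (suc a ∷ as) z →
           FundSeq B lo (suc (suc a) ∷ as) (k ∷ z)

FundSeq-lower : ∀ {B lo α k z} → FundSeq B lo α (k ∷ z) → lo ≤ k
FundSeq-lower (close lo≤k _ _) = lo≤k
FundSeq-lower (extend lo≤k _ _) = lo≤k

FundSeq-≥ : ∀ {B lo α z} → FundSeq B lo α z → All (lo ≤_) z
FundSeq-≥ [] = []
FundSeq-≥ (close lo≤k _ f) = lo≤k ∷ All.map (λ k<x → ≤-trans lo≤k (<⇒≤ k<x)) (FundSeq-≥ f)
FundSeq-≥ (extend lo≤k _ f) = lo≤k ∷ All.map (≤-trans lo≤k) (FundSeq-≥ f)

-- Each later part needs a strictly larger value, all of them at most B.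
FundSeq-head-bound : ∀ {B lo α k z} → FundSeq B lo α (k ∷ z) → k + length α ≤ suc B
FundSeq-head-bound {B} {k = k} (close _ k≤B []) = subst (_≤ suc B) (+-comm 1 k) (s≤s k≤B)
FundSeq-head-bound {k = k} (close {as = as} {z = _ ∷ _} _ _ f) =
  ≤-trans (≤-reflexive (+-suc k (length as))) (≤-trans (+-monoˡ-≤ (length as) (FundSeq-lower f)) (FundSeq-head-bound f))
FundSeq-head-bound (extend {as = as} {z = _ ∷ _} _ _ f) =
  ≤-trans (+-monoˡ-≤ (suc (length as)) (FundSeq-lower f)) (FundSeq-head-bound f)

s+1+n≡1+B⇒s≤B : ∀ {s n B} → s + suc n ≡ suc B → s ≤ B
s+1+n≡1+B⇒s≤B {s} {n} eq = ≤-trans (m≤m+n s n) (≤-reflexive (suc-injective (trans (sym (+-suc s n)) eq)))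

FundSeq-head≤s : ∀ {B lo α k z s} → s + length α ≡ suc B → FundSeq B lo α (k ∷ z) → k ≤ s
FundSeq-head≤s {α = α} {k} eq f = +-cancelʳ-≤ (length α) k _ (subst (k + length α ≤_) (sym eq) (FundSeq-head-bound f))

-- The composition is generalised to a variable α so that it can be matched on.
PathLabelling⇒FundSeq : ∀ {lo s B} t {α z} → IsPath t → pathComposition t ≡ α → s + length α ≡ suc B →
  PathLabelling lo s t z → FundSeq B lo α z
PathLabelling⇒FundSeq leaf _ refl _ stop = []
PathLabelling⇒FundSeq {s = s} (node leaf r) path refl eq (goRight lo≤k k≤s p) =
  close lo≤k (≤-trans k≤s (s+1+n≡1+B⇒s≤B eq)) (PathLabelling⇒FundSeq r path refl (trans (1+[s+m]+n≡s+[m+1+n] s 0 _) eq) p)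
PathLabelling⇒FundSeq (node (node a b) leaf) path αeq eq (goLeft lo≤k k≤s p) with pathComposition-nonempty {a} {b} path
... | c , cs , e with trans (sym αeq) (cong incrHead e)
... | refl = extend lo≤k (≤-trans k≤s (s+1+n≡1+B⇒s≤B eq)) (PathLabelling⇒FundSeq (node a b) path e eq p)

FundSeq⇒PathLabelling : ∀ {lo s B} t {α z} → IsPath t → pathComposition t ≡ α → s + length α ≡ suc B →
  FundSeq B lo α z → PathLabelling lo s t z
FundSeq⇒PathLabelling leaf _ refl _ [] = stop
FundSeq⇒PathLabelling {s = s} (node leaf r) path refl eq f@(close lo≤k _ f′) =
  goRight lo≤k (FundSeq-head≤s eq f) (FundSeq⇒PathLabelling r path refl (trans (1+[s+m]+n≡s+[m+1+n] s 0 _) eq) f′)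
FundSeq⇒PathLabelling (node (node a b) leaf) path αeq eq f with pathComposition-nonempty {a} {b} path
... | c , cs , e with trans (sym αeq) (cong incrHead e) | f
... | refl | extend lo≤k _ f′ = goLeft lo≤k (FundSeq-head≤s eq f) (FundSeq⇒PathLabelling (node a b) path e eq f′)

PathLabelling⇔FundSeq : ∀ {lo s B} t {z} → IsPath t → s + length (pathComposition t) ≡ suc B →
  PathLabelling lo s t z ⇔ FundSeq B lo (pathComposition t) z
PathLabelling⇔FundSeq t path eq = mk⇔ (PathLabelling⇒FundSeq t path refl eq) (FundSeq⇒PathLabelling t path refl eq)

IsDescentAt : ℕ → List ℕ → Bool
IsDescentAt p D = any (λ q → p ≡ᵇ q) D

fundOK-strict : ∀ {D p a b is} → IsDescentAt p D ≡ true →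
  fundOK D p (a ∷ b ∷ is) ≡ true ⇔ (a < b × fundOK D (suc p) (b ∷ is) ≡ true)
fundOK-strict eq rewrite eq = ⇔.trans ∧-≡true⇔ (<ᵇ-≡true⇔ ×-⇔ ⇔.refl)

fundOK-weak : ∀ {D p a b is} → IsDescentAt p D ≡ false →
  fundOK D p (a ∷ b ∷ is) ≡ true ⇔ (a ≤ b × fundOK D (suc p) (b ∷ is) ≡ true)
fundOK-weak eq rewrite eq = ⇔.trans ∧-≡true⇔ (≤ᵇ-≡true⇔ ×-⇔ ⇔.refl)

IsDescentAt-below : ∀ {p D} → All (p <_) D → IsDescentAt p D ≡ false
IsDescentAt-below [] = refl
IsDescentAt-below (p<q ∷ p<D) rewrite ≢⇒≡ᵇ-false (<⇒≢ p<q) = IsDescentAt-below p<D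

fundOK-drop : ∀ {x D p} z → x < p → fundOK (x ∷ D) p z ≡ fundOK D p z
fundOK-drop [] _ = refl
fundOK-drop (a ∷ []) _ = refl
fundOK-drop {x} {D} {p} (a ∷ b ∷ is) x<p
  rewrite fundOK-drop {x} {D} {suc p} (b ∷ is) (m<n⇒m<1+n x<p) | ≢⇒≡ᵇ-false (>⇒≢ x<p) = refl

descentSet-shift : ∀ acc a as → descentSet acc (suc a ∷ as) ≡ descentSet (suc acc) (a ∷ as)
descentSet-shift acc a [] = refl
descentSet-shift acc a (b ∷ bs) = cong (λ x → x ∷ descentSet x (b ∷ bs)) (+-suc acc a)

descentSet-lower : ∀ acc a as → All (acc + a ≤_) (descentSet acc (a ∷ as))
descentSet-lower acc a [] = []
descentSet-lower acc a (b ∷ bs) = ≤-refl ∷ All.map (≤-trans (m≤m+n (acc + a) b)) (descentSet-lower (acc + a) b bs)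

HeadAtLeast : ℕ → List ℕ → Set
HeadAtLeast lo [] = ⊤
HeadAtLeast lo (k ∷ _) = lo ≤ k

-- The conditions of fundamental n α, for the suffix of positions acc+1, acc+2, ….
FundConditions : ℕ → ℕ → ℕ → List ℕ → List ℕ → Set
FundConditions B lo acc α z =
  HeadAtLeast lo z × fundOK (descentSet acc α) (suc acc) z ≡ true × length z ≡ sum α × All (_≤ B) z

descentAtPart : ∀ acc b bs → IsDescentAt (suc acc) (descentSet acc (1 ∷ b ∷ bs)) ≡ true
descentAtPart acc b bs rewrite ≡⇒≡ᵇ-true (+-comm 1 acc) = refl

noDescentInPart : ∀ acc a as → IsDescentAt (suc acc) (descentSet acc (suc (suc a) ∷ as)) ≡ false
noDescentInPart acc a as =
  IsDescentAt-below (All.map (<-≤-trans 1+acc<acc+2+a) (descentSet-lower acc (suc (suc a)) as))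
  where
  1+acc<acc+2+a : suc acc < acc + suc (suc a)
  1+acc<acc+2+a = subst (_≤ acc + suc (suc a)) (+-comm acc 2) (+-monoʳ-≤ acc (s≤s (s≤s z≤n)))

fundOK-nextPart : ∀ acc b bs z →
  fundOK (descentSet acc (1 ∷ b ∷ bs)) (suc (suc acc)) z ≡ fundOK (descentSet (acc + 1) (b ∷ bs)) (suc (acc + 1)) z
fundOK-nextPart acc b bs z rewrite +-comm acc 1 = fundOK-drop z ≤-refl

FundSeq⇒FundConditions : ∀ {B lo α z} acc → FundSeq B lo α z → FundConditions B lo acc α z
FundSeq⇒FundConditions acc [] = _ , refl , refl , []
FundSeq⇒FundConditions acc (close lo≤k k≤B []) = lo≤k , refl , refl , k≤B ∷ []
FundSeq⇒FundConditions acc (close {as = b ∷ bs} {z = k′ ∷ z′} lo≤k k≤B f) with FundSeq⇒FundConditions (acc + 1) f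
... | k<k′ , ok , len , ≤B =
  lo≤k , from (fundOK-strict {descentSet acc (1 ∷ b ∷ bs)} {suc acc} {is = z′} (descentAtPart acc b bs))
           (k<k′ , trans (fundOK-nextPart acc b bs (k′ ∷ z′)) ok) ,
  cong suc len , k≤B ∷ ≤B
FundSeq⇒FundConditions acc (extend {a = a} {as} {z = k′ ∷ z′} lo≤k k≤B f) with FundSeq⇒FundConditions (suc acc) f
... | k≤k′ , ok , len , ≤B =
  lo≤k , from (fundOK-weak {descentSet acc (suc (suc a) ∷ as)} {suc acc} {is = z′} (noDescentInPart acc a as))
           (k≤k′ , subst (λ D → fundOK D (suc (suc acc)) (k′ ∷ z′) ≡ true) (sym (descentSet-shift acc (suc a) as)) ok) ,
  cong suc len , k≤B ∷ ≤B

FundConditions⇒FundSeq : ∀ {B lo} acc α z → All (1 ≤_) α → FundConditions B lo acc α z → FundSeq B lo α z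
FundConditions⇒FundSeq _ [] [] _ _ = []
FundConditions⇒FundSeq _ [] (_ ∷ _) _ (_ , _ , () , _)
FundConditions⇒FundSeq _ (zero ∷ _) _ (() ∷ _) _
FundConditions⇒FundSeq _ (suc _ ∷ _) [] _ (_ , _ , () , _)
FundConditions⇒FundSeq _ (1 ∷ []) (k ∷ []) _ (lo≤k , _ , _ , k≤B ∷ []) = close lo≤k k≤B []
FundConditions⇒FundSeq _ (1 ∷ []) (_ ∷ _ ∷ _) _ (_ , _ , () , _)
FundConditions⇒FundSeq _ (1 ∷ b ∷ bs) (k ∷ []) (_ ∷ 1≤b ∷ _) (_ , _ , len , _) =
  contradiction (suc-injective len) (<⇒≢ (≤-trans 1≤b (m≤m+n b (sum bs))))
FundConditions⇒FundSeq acc (1 ∷ b ∷ bs) (k ∷ k′ ∷ z′) (_ ∷ pos) (lo≤k , ok , len , k≤B ∷ ≤B) =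
  close lo≤k k≤B (FundConditions⇒FundSeq (acc + 1) (b ∷ bs) (k′ ∷ z′) pos
    (proj₁ step , trans (sym (fundOK-nextPart acc b bs (k′ ∷ z′))) (proj₂ step) , suc-injective len , ≤B))
  where
  step = to (fundOK-strict {descentSet acc (1 ∷ b ∷ bs)} {suc acc} {is = z′} (descentAtPart acc b bs)) ok
FundConditions⇒FundSeq _ (suc (suc _) ∷ _) (_ ∷ []) _ (_ , _ , () , _)
FundConditions⇒FundSeq acc (suc (suc a) ∷ as) (k ∷ k′ ∷ z′) (_ ∷ pos) (lo≤k , ok , len , k≤B ∷ ≤B) =
  extend lo≤k k≤B (FundConditions⇒FundSeq (suc acc) (suc a ∷ as) (k′ ∷ z′) (s≤s z≤n ∷ pos)
    (proj₁ step , subst (λ D → fundOK D (suc (suc acc)) (k′ ∷ z′) ≡ true) (descentSet-shift acc (suc a) as) (proj₂ step) ,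
     suc-injective len , ≤B))
  where
  step = to (fundOK-weak {descentSet acc (suc (suc a) ∷ as)} {suc acc} {is = z′} (noDescentInPart acc a as)) ok

∈-fundamental⇔FundSeq : ∀ {n α z} → All (1 ≤_) α → z ∈ fundamental n α ⇔ FundSeq n 1 α z
∈-fundamental⇔FundSeq {n} {α} {z} pos = mk⇔ to′ from′
  where
  fundOK? : Decidable (λ z → fundOK (descentSet 0 α) 1 z ≡ true)
  fundOK? z = fundOK (descentSet 0 α) 1 z Data.Bool.≟ true
  to′ : z ∈ fundamental n α → FundSeq n 1 α z
  to′ z∈ with ∈-filter⁻ fundOK? z∈
  ... | z∈all , ok with to (∈-allLists⇔ (sum α) n z) z∈all
  ... | len , inRange = FundConditions⇒FundSeq 0 α z pos (head inRange , ok , len , All.map proj₂ inRange)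
    where
    head : ∀ {z} → All (InRange n) z → HeadAtLeast 1 z
    head [] = _
    head ((1≤k , _) ∷ _) = 1≤k
  from′ : FundSeq n 1 α z → z ∈ fundamental n α
  from′ f with FundSeq⇒FundConditions 0 f
  ... | _ , ok , len , ≤n = ∈-filter⁺ fundOK? (from (∈-allLists⇔ (sum α) n z) (len , All.zip (FundSeq-≥ f , ≤n))) ok

module ≈ₚ = ↭ₛ (↭.↭-setoid {A = ℕ})

forestPoly-path : ∀ {j t} F → blocks F ≡ [ (suc j , t) ] → IsPath t →
  forestPoly F ≈ₚ fundamental (length (pathComposition t) + j) (pathComposition t)
forestPoly-path {j} {t} F blocks≡ path =
  ≈ₚ.↭-trans (↭.↭⇒↭ₛ′ ↭-isEquivalence forestPoly↭image)
             (≈ₚ.↭-reflexive-≋ (map-Pointwise (inorder t) (All.map inorder-↭ labellings)))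
  where
  C = pathComposition t
  n = length C + j
  FD = fundamental n C
  ∈FD⇔PathLabelling : ∀ {z} → z ∈ FD ⇔ PathLabelling 1 (suc j) t z
  ∈FD⇔PathLabelling = ⇔.trans (∈-fundamental⇔FundSeq (pathComposition-positive t path))
                               (⇔.sym (PathLabelling⇔FundSeq t path (cong suc (+-comm j (length C)))))
  labellings : All (PathLabelling 1 (suc j) t) FD
  labellings = All.tabulate (to ∈FD⇔PathLabelling)
  ∈image⇔okT : ∀ {κ} → κ ∈ map (inorder t) FD ⇔ okT 1 (suc j) t κ ≡ true
  ∈image⇔okT = mk⇔ to′ from′
    where
    to′ : ∀ {κ} → κ ∈ map (inorder t) FD → okT 1 (suc j) t κ ≡ true
    to′ κ∈ with ∈-map⁻ (inorder t) κ∈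
    ... | z , z∈ , refl = PathLabelling⇒okT (to ∈FD⇔PathLabelling z∈)
    from′ : ∀ {κ} → okT 1 (suc j) t κ ≡ true → κ ∈ map (inorder t) FD
    from′ ok with okT⇒PathLabelling t path ok
    ... | z , p , refl = ∈-map⁺ (inorder t) (from ∈FD⇔PathLabelling p)
  forestPoly↭image : forestPoly F ↭ map (inorder t) FD
  forestPoly↭image = ∼bag⇒↭ (unique∧set⇒bag
    (Unique.filter⁺ (λ κ → okF (blocks F) κ Data.Bool.≟ true) (allLists-unique (numNodes F) (labelBound F)))
    (Unique-map⁺ (inorder t) inorder-injective labellings
      (Unique.filter⁺ (λ z → fundOK (descentSet 0 C) 1 z Data.Bool.≟ true) (allLists-unique (sum C) n)))
    (⇔.trans (∈-forestPoly⇔okT F blocks≡) (⇔.sym ∈image⇔okT)))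

linear⇒forestPoly≈fundamental : (F : IndFor₊) → IsLinear F → ∀ j α → All (1 ≤_) α →
  HasShape (cF F) j α → forestPoly F ≈ₚ fundamental (length α + j) α
linear⇒forestPoly≈fundamental F@(indFor _ (_ ∷ []) (s≤s _ ∷ []) _) ((suc j′ , node l r) , refl , path) j α αpos hasShape
  with pathComposition-nonempty {l} {r} path
... | _ , _ , eq with HasShape-unique αpos (subst (All (1 ≤_)) eq (pathComposition-positive (node l r) path))
                        hasShape (subst (HasShape (cF F) j′) eq (pathBlock-HasShape F refl path))
... | refl , α≡ with trans α≡ (sym eq)
... | refl = forestPoly-path F refl path

proposition3p10 : (F : IndFor₊) →
    (IsLinear F ⇔ IsInterval (SuppC F))
    × (IsInterval (SuppC F) ⇔ IsInterval (InLSupp F))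
    × (IsLinear F → (j : ℕ) (α : List ℕ) → All (λ a → 1 ≤ a) α
        → (∀ i → 1 ≤ i → i ≤ j → cF F i ≡ 0)
        → (∀ (s : Fin (length α)) → cF F (j + suc (toℕ s)) ≡ lookup α s)
        → (∀ i → j + length α < i → cF F i ≡ 0)
        → forestPoly F ≈ₚ fundamental (length α + j) α)
proposition3p10 F =
  ⇔.trans (IsLinear⇔IsInterval-LSuppBlocks F) (IsInterval-cong (λ i → ⇔.sym (SuppC⇔LSuppBlocks F i))) ,
  IsInterval-cong (λ i → ⇔.trans (SuppC⇔LSuppBlocks F i) (⇔.sym (InLSupp⇔LSuppBlocks F i))) ,
  λ linear j α αpos leading parts trailing →
    linear⇒forestPoly≈fundamental F linear j α αpos (HasShape-intro leading parts trailing)
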